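{- Let $n>1$ be odd and $A=U(n)$. If $S$ is an $A$-extremal sequence in $\mathbb{Z}_n$ and $q$ is a prime divisor of $n$, then $q$ is coprime to at least one term of $S$.
   Context: $\mathbb{Z}_n=\mathbb{Z}/n\mathbb{Z}$, $U(n)$ its group of units. A sequence $(x_1,\ldots,x_k)$ ($k\ge1$) in $\mathbb{Z}_n$ is an $A$-weighted zero-sum sequence if there exist $a_1,\ldots,a_k\in A$ with $a_1x_1+\cdots+a_kx_k=0$. A subsequence of consecutive terms is a nonempty block $(x_i,\ldots,x_j)$. $C_A(n)$ is the least positive integer $k$ such that every sequence of length $k$ in $\mathbb{Z}_n$ has an $A$-weighted zero-sum subsequence of consecutive terms. A sequence in $\mathbb{Z}_n$ is $A$-extremal if it has length $C_A(n)-1$ and has no $A$-weighted zero-sum subsequence of consecutive terms. A prime $q\mid n$ is coprime to $x\in\mathbb{Z}_n$ if $q$ does not divide the integer representatives of $x$. -}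

module Defs where

open import Data.Nat using (ℕ; suc; _≤_; _<_; _∸_)
open import Data.Nat.Divisibility using (_∣_)
open import Data.Nat.Coprimality using (Coprime)
open import Data.Fin using (Fin; toℕ)
open import Data.List using (List; []; _∷_; _++_; length; zipWith; map)
open import Data.Nat.ListAction using (sum)
open import Data.List.Relation.Unary.All using (All)
open import Data.Vec using (Vec; toList)
open import Data.Product using (Σ; ∃; _×_; _,_)
open import Relation.Nullary using (¬_)
open import Relation.Binary.PropositionalEquality using (_≡_)

-- Elements of ℤ_n are represented by Fin n (canonical representatives 0..n-1).

IsUnit : (n : ℕ) → Fin n → Set
IsUnit n a = Coprime (toℕ a) n

WeightedZeroSum : (n : ℕ) → List (Fin n) → Set
WeightedZeroSum n xs =
  (1 ≤ length xs) ×
  Σ (List (Fin n)) λ ws →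
    (length ws ≡ length xs) × All (IsUnit n) ws ×
    (n ∣ sum (zipWith (λ a x → toℕ a Data.Nat.* toℕ x) ws xs))

HasZSBlock : (n : ℕ) → List (Fin n) → Set
HasZSBlock n xs =
  Σ (List (Fin n)) λ pre → Σ (List (Fin n)) λ blk → Σ (List (Fin n)) λ post →
    (xs ≡ pre ++ blk ++ post) × WeightedZeroSum n blk

AllHaveZSBlock : (n k : ℕ) → Set
AllHaveZSBlock n k = (s : Vec (Fin n) k) → HasZSBlock n (toList s)

IsC : (n c : ℕ) → Set
IsC n c = (1 ≤ c) × AllHaveZSBlock n c × (∀ k → 1 ≤ k → k < c → ¬ AllHaveZSBlock n k)

Extremal : (n : ℕ) → List (Fin n) → Set
Extremal n s = Σ ℕ λ c → IsC n c × (length s ≡ c ∸ 1) × ¬ HasZSBlock n s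

-- Suppose the prime q | n divides every term of an extremal sequence S. Appending any
-- y ∈ ℤ_n gives a sequence of length C_{U(n)}(n), so S ∷ʳ y contains a weighted
-- zero-sum block; S has none, so the block ends with y. Reducing its weighted sum
-- modulo q kills every term except w·y with w a unit, and q ∤ w, so q | y. Taking
-- y = 1 is absurd. The argument does not use that n is odd.
module Submission where

open import Defs
open import Data.Nat using (ℕ; suc; _<_; _≤_; _+_; _*_)
open import Data.Nat.Properties using (+-comm; +-identityʳ; m∸n+n≡m; suc-injective)
open import Data.Nat.Divisibility using (_∣_; _∣?_; ∣-trans; ∣1⇒≡1; ∣m+n∣m⇒∣n; ∣n⇒∣m*n)
open import Data.Nat.Primality using (Prime; euclidsLemma; ¬prime[1])
open import Data.Nat.ListAction using (sum)
open import Data.Fin using (Fin; toℕ; fromℕ<)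
open import Data.Fin.Properties using (toℕ-fromℕ<)
open import Data.List using (List; []; _∷_; _++_; _∷ʳ_; length; zipWith; initLast; _∷ʳ′_)
open import Data.List.Properties using (++-assoc; ++-identityʳ; length-++; ∷ʳ-injective)
open import Data.List.Relation.Unary.Any using (Any; any?)
open import Data.List.Relation.Unary.All using (All; []; _∷_)
import Data.List.Relation.Unary.All as All
open import Data.List.Relation.Unary.All.Properties using (++⁻ʳ; ¬Any⇒All¬)
open import Data.Vec using (fromList)
open import Data.Vec.Properties using (toList∘fromList)
open import Data.Product using (∃; _×_; _,_; proj₁)
open import Data.Sum using (_⊎_; inj₁; inj₂)
open import Relation.Nullary using (¬_; yes; no; ¬?; contradiction)
open import Relation.Nullary.Decidable using (decidable-stable)
open import Relation.Binary.PropositionalEquality using (_≡_; refl; sym; trans; cong; subst)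

++-∷ʳ : ∀ {A : Set} (xs ys : List A) (z : A) → xs ++ ys ∷ʳ z ≡ (xs ++ ys) ∷ʳ z
++-∷ʳ xs ys z = sym (++-assoc xs ys (z ∷ []))

block-of-∷ʳ : ∀ {A : Set} (xs : List A) (y : A) (pre blk post : List A) → 1 ≤ length blk →
  xs ∷ʳ y ≡ pre ++ blk ++ post →
  (∃ λ post′ → xs ≡ pre ++ blk ++ post′) ⊎ (∃ λ blk′ → blk ≡ blk′ ∷ʳ y × xs ≡ pre ++ blk′)
block-of-∷ʳ xs y pre blk post 1≤|blk| eq with initLast post | initLast blk
... | post′ ∷ʳ′ z | _ =
  inj₁ (post′ , proj₁ (∷ʳ-injective xs _
    (trans eq (trans (cong (pre ++_) (++-∷ʳ blk post′ z)) (++-∷ʳ pre _ z)))))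
block-of-∷ʳ xs y pre .[] .[] () eq | [] | []
block-of-∷ʳ xs y pre .(blk′ ∷ʳ z) .[] _ eq | [] | blk′ ∷ʳ′ z
  with ∷ʳ-injective xs (pre ++ blk′)
         (trans eq (trans (cong (pre ++_) (++-identityʳ _)) (++-∷ʳ pre blk′ z)))
... | xs≡ , refl = inj₂ (blk′ , refl , xs≡)

weightedSum : ∀ {n} → List (Fin n) → List (Fin n) → ℕ
weightedSum ws xs = sum (zipWith (λ a x → toℕ a * toℕ x) ws xs)

prime∣n⇒∤unit : ∀ {n q} (a : Fin n) → Prime q → q ∣ n → IsUnit n a → ¬ q ∣ toℕ a
prime∣n⇒∤unit a q-prime q∣n a-unit q∣a = ¬prime[1] (subst Prime (a-unit (q∣a , q∣n)) q-prime)

∣-weightedSum-∷ʳ⇒∣ : ∀ {n q} → Prime q → q ∣ n → (y : Fin n) (xs ws : List (Fin n)) →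
  All (λ x → q ∣ toℕ x) xs → All (IsUnit n) ws → length ws ≡ suc (length xs) →
  q ∣ weightedSum ws (xs ∷ʳ y) → q ∣ toℕ y
∣-weightedSum-∷ʳ⇒∣ {q = q} q-prime q∣n y [] (w ∷ []) _ (w-unit ∷ _) _ q∣Σ
  with euclidsLemma (toℕ w) (toℕ y) q-prime (subst (q ∣_) (+-identityʳ _) q∣Σ)
... | inj₁ q∣w = contradiction q∣w (prime∣n⇒∤unit w q-prime q∣n w-unit)
... | inj₂ q∣y = q∣y
∣-weightedSum-∷ʳ⇒∣ q-prime q∣n y (x ∷ xs) (w ∷ ws) (q∣x ∷ q∣xs) (_ ∷ units) |ws|≡ q∣Σ =
  ∣-weightedSum-∷ʳ⇒∣ q-prime q∣n y xs ws q∣xs units (suc-injective |ws|≡)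
    (∣m+n∣m⇒∣n q∣Σ (∣n⇒∣m*n (toℕ w) q∣x))

extremal-∷ʳ-hasZSBlock : ∀ {n} {S : List (Fin n)} → Extremal n S → (y : Fin n) →
  HasZSBlock n (S ∷ʳ y)
extremal-∷ʳ-hasZSBlock {n} {S} (c , (1≤c , allHave , _) , |S|≡c∸1 , _) y =
  subst (HasZSBlock n) (toList∘fromList (S ∷ʳ y))
    (subst (AllHaveZSBlock n) c≡|S∷ʳy| allHave (fromList (S ∷ʳ y)))
  where
  c≡|S∷ʳy| : c ≡ length (S ∷ʳ y)
  c≡|S∷ʳy| = sym (trans (length-++ S) (trans (cong (_+ 1) |S|≡c∸1) (m∸n+n≡m 1≤c)))

extremal-common-divisor⇒∣-all : ∀ {n q} {S : List (Fin n)} → Extremal n S →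
  Prime q → q ∣ n → All (λ x → q ∣ toℕ x) S → (y : Fin n) → q ∣ toℕ y
extremal-common-divisor⇒∣-all {S = S} ext@(_ , _ , _ , noBlock) q-prime q∣n q∣S y
  with pre , blk , post , eq , 1≤|blk| , ws , |ws|≡|blk| , units , n∣Σ ← extremal-∷ʳ-hasZSBlock ext y
  with block-of-∷ʳ S y pre blk post 1≤|blk| eq
... | inj₁ (post′ , S≡) = contradiction (pre , blk , post′ , S≡ , 1≤|blk| , ws , |ws|≡|blk| , units , n∣Σ) noBlock
... | inj₂ (blk′ , refl , refl) =
  ∣-weightedSum-∷ʳ⇒∣ q-prime q∣n y blk′ ws (++⁻ʳ pre q∣S) units
    (trans |ws|≡|blk| (trans (length-++ blk′) (+-comm (length blk′) 1))) (∣-trans q∣n n∣Σ)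

mainTheorem18 : (n : ℕ) → 1 < n → ¬ (2 ∣ n) →
    (S : List (Fin n)) → Extremal n S →
    (q : ℕ) → Prime q → q ∣ n →
    Any (λ x → ¬ (q ∣ toℕ x)) S
mainTheorem18 n 1<n _ S ext q q-prime q∣n with any? (λ x → ¬? (q ∣? toℕ x)) S
... | yes found = found
... | no none = contradiction (subst Prime (∣1⇒≡1 q∣1) q-prime) ¬prime[1]
  where
  q∣S : All (λ x → q ∣ toℕ x) S
  q∣S = All.map (decidable-stable (q ∣? _)) (¬Any⇒All¬ S none)
  q∣1 : q ∣ 1
  q∣1 = subst (q ∣_) (toℕ-fromℕ< 1<n)
    (extremal-common-divisor⇒∣-all ext q-prime q∣n q∣S (fromℕ< 1<n))
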